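{- Let $G$ be a finite bipartite graph with bipartition $(X,Y)$. If the independence graph $I(G)$ is a comparability graph, then $\overline{G}$ has a $T$-free orientation.
   Context: Two edges $xy,x'y'$ of $G$ ($x,x'\in X$, $y,y'\in Y$) are independent if they are disjoint and $xy'\notin E(G)$, $x'y\notin E(G)$. $I(G)$ has vertex set $E(G)$, with two edges adjacent iff independent. A comparability graph is a graph admitting a transitive orientation. $\overline{G}$ is the complement of $G$. An orientation of $\overline{G}$ is a mixed graph in which every edge of $\overline{G}$ between $X$ and $Y$ (i.e., every non-edge $xy$ of $G$ with $x\in X,y\in Y$) stays undirected and every pair of distinct vertices both in $X$ or both in $Y$ is oriented in exactly one direction. It is $T$-free if there are no $x,x'\in X$, $y,y'\in Y$ with $xy, x'y'\notin E(G)$, $xy', x'y\in E(G)$, such that it contains both arcs $x\to x'$ and $y\to y'$. -}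

module Defs where

open import Data.Nat using (ℕ)
open import Data.Fin using (Fin)
open import Data.Bool using (Bool; true; false)
open import Data.Product using (Σ; ∃; _×_; _,_)
open import Data.Sum using (_⊎_)
open import Relation.Nullary using (¬_)
open import Relation.Binary.PropositionalEquality using (_≡_; _≢_)

-- A finite bipartite graph G with bipartition (X , Y), X = Fin m, Y = Fin n,
-- given by its (decidable) edge relation between X and Y.
record BipGraph (m n : ℕ) : Set where
  field
    adj : Fin m → Fin n → Bool

module _ {m n : ℕ} (G : BipGraph m n) where
  open BipGraph G

  IsEdge : Fin m → Fin n → Set
  IsEdge x y = adj x y ≡ true

  -- the edge set E(G) = vertex set of I(G)
  Edge : Set
  Edge = Σ (Fin m × Fin n) (λ { (x , y) → IsEdge x y })

  Independent : Edge → Edge → Set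
  Independent ((x , y) , _) ((x' , y') , _) =
    x ≢ x' × y ≢ y' × ¬ IsEdge x y' × ¬ IsEdge x' y

IsTransitiveOrientation : {V : Set} → (V → V → Set) → (V → V → Set) → Set
IsTransitiveOrientation {V} Adj R =
  (∀ u v → Adj u v → (R u v ⊎ R v u)) ×
  (∀ u v → R u v → R v u → Data.Empty.⊥) ×
  (∀ u v → R u v → Adj u v) ×
  (∀ u v w → R u v → R v w → R u w)
  where import Data.Empty

IsComparabilityGraph : {V : Set} → (V → V → Set) → Set₁
IsComparabilityGraph {V} Adj = Σ (V → V → Set) (λ R → IsTransitiveOrientation Adj R)

IComparability : {m n : ℕ} → BipGraph m n → Set₁
IComparability G = IsComparabilityGraph (Independent G)

-- An orientation of the complement: the X–Y non-edges stay undirected (nothing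
-- to choose); each pair of distinct vertices on the same side is oriented in
-- exactly one direction.
record ComplementOrientation {m n : ℕ} (G : BipGraph m n) : Set₁ where
  field
    arcX : Fin m → Fin m → Set
    arcY : Fin n → Fin n → Set
    arcX-irrefl : ∀ x → ¬ arcX x x
    arcY-irrefl : ∀ y → ¬ arcY y y
    arcX-total : ∀ x x' → x ≢ x' → arcX x x' ⊎ arcX x' x
    arcY-total : ∀ y y' → y ≢ y' → arcY y y' ⊎ arcY y' y
    arcX-asym : ∀ x x' → arcX x x' → ¬ arcX x' x
    arcY-asym : ∀ y y' → arcY y y' → ¬ arcY y' y

TFree : {m n : ℕ} (G : BipGraph m n) → ComplementOrientation G → Set
TFree G O =
  ∀ x x' y y' →
    ¬ IsEdge G x y → ¬ IsEdge G x' y' → IsEdge G x y' → IsEdge G x' y →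
    ¬ (arcX x x' × arcY y y')
  where open ComplementOrientation O

module Submission where

-- Call (x , x' , y , y') a T-configuration of G when xy, x'y' are
-- non-edges and xy', x'y are edges.  Its two "diagonal" edges xy' and x'y are
-- independent, so a transitive orientation R of I(G) orients them: forward
-- (xy' → x'y) or backward.  The key observation is coherence: all
-- T-configurations on the same pair x, x' are oriented the same way, because
-- in a transitive orientation two edges with a common endpoint are never
-- comparable.  Hence "some T-configuration on (x , x') is forward" is an
-- asymmetric relation on X, defined (in one direction) on every pair carrying
-- a T-configuration; ordering the remaining pairs by the order of Fin yields
-- a tournament on X.  The Y side is the same construction for the transposed
-- graph, where forward configurations are exactly the backward ones of G.
-- A T configured with x → x' and y → y' would then be both forward and
-- backward, contradicting coherence in G or in its transpose.

open import Defs
open import Data.Nat using (ℕ)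
open import Data.Fin using (Fin; _<_)
open import Data.Fin.Properties using (any?; <-cmp; <-irrefl; <-asym)
open import Data.Bool using (true)
open import Data.Bool.Properties using () renaming (_≟_ to _≟ᵇ_)
open import Data.Product using (Σ; ∃-syntax; _×_; _,_; proj₁; proj₂)
open import Data.Sum using (_⊎_; inj₁; inj₂; swap) renaming (map to map-⊎)
open import Data.Empty using (⊥-elim)
open import Function using (_∘_)
open import Relation.Nullary using (¬_; Dec; yes; no)
open import Relation.Nullary.Decidable using (¬?; _×-dec_; map′)
open import Relation.Binary.Definitions using (tri<; tri≈; tri>)
open import Relation.Binary.PropositionalEquality using (_≢_; refl)

pullback-transitive :
  {U V : Set} {AdjU : U → U → Set} {AdjV : V → V → Set} {R : V → V → Set}
  (f : U → V) →
  (∀ u v → AdjU u v → AdjV (f u) (f v)) →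
  (∀ u v → AdjV (f u) (f v) → AdjU u v) →
  IsTransitiveOrientation AdjV R →
  IsTransitiveOrientation AdjU (λ u v → R (f u) (f v))
pullback-transitive f preserve reflect (total , asym , sound , trans) =
    (λ u v → total (f u) (f v) ∘ preserve u v)
  , (λ u v → asym (f u) (f v))
  , (λ u v → reflect u v ∘ sound (f u) (f v))
  , (λ u v w → trans (f u) (f v) (f w))

module Completion {k : ℕ} (C : Fin k → Fin k → Set)
  (C? : ∀ a b → Dec (C a b)) (W : Fin k → Fin k → Set)
  (W-total : ∀ {a b} → C a b → W a b ⊎ W b a)
  (W-sound : ∀ {a b} → W a b → C a b)
  (W-asym : ∀ {a b} → W a b → ¬ W b a) where

  arc : Fin k → Fin k → Set
  arc a b = W a b ⊎ (¬ C a b × ¬ C b a × a < b)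

  arc-irrefl : ∀ a → ¬ arc a a
  arc-irrefl a (inj₁ w) = W-asym w w
  arc-irrefl a (inj₂ (_ , _ , a<a)) = <-irrefl refl a<a

  arc-asym : ∀ a b → arc a b → ¬ arc b a
  arc-asym a b (inj₁ w) (inj₁ w') = W-asym w w'
  arc-asym a b (inj₁ w) (inj₂ (_ , ¬Cab , _)) = ¬Cab (W-sound w)
  arc-asym a b (inj₂ (_ , ¬Cba , _)) (inj₁ w') = ¬Cba (W-sound w')
  arc-asym a b (inj₂ (_ , _ , a<b)) (inj₂ (_ , _ , b<a)) = <-asym a<b b<a

  arc-total : ∀ a b → a ≢ b → arc a b ⊎ arc b a
  arc-total a b a≢b with C? a b | C? b a
  ... | yes Cab | _ = map-⊎ inj₁ inj₁ (W-total Cab)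
  ... | no _ | yes Cba = swap (map-⊎ inj₁ inj₁ (W-total Cba))
  ... | no ¬Cab | no ¬Cba with <-cmp a b
  ...   | tri< a<b _ _ = inj₁ (inj₂ (¬Cab , ¬Cba , a<b))
  ...   | tri≈ _ a≡b _ = ⊥-elim (a≢b a≡b)
  ...   | tri> _ _ b<a = inj₂ (inj₂ (¬Cba , ¬Cab , b<a))

  arc-agrees : ∀ {a b} → arc a b → C a b → W a b
  arc-agrees (inj₁ w) _ = w
  arc-agrees (inj₂ (¬Cab , _)) Cab = ⊥-elim (¬Cab Cab)

transpose : {m n : ℕ} → BipGraph m n → BipGraph n m
transpose G = record { adj = λ y x → BipGraph.adj G x y }

module _ {m n : ℕ} (G : BipGraph m n) where

  flipEdge : Edge (transpose G) → Edge G
  flipEdge ((y , x) , p) = (x , y) , p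

  independent-transpose : ∀ u v →
    Independent (transpose G) u v → Independent G (flipEdge u) (flipEdge v)
  independent-transpose _ _ (y≢y' , x≢x' , ¬x'y , ¬xy') = x≢x' , y≢y' , ¬xy' , ¬x'y

  independent-untranspose : ∀ u v →
    Independent G (flipEdge u) (flipEdge v) → Independent (transpose G) u v
  independent-untranspose _ _ (x≢x' , y≢y' , ¬xy' , ¬x'y) = y≢y' , x≢x' , ¬x'y , ¬xy'

  record Tee (x x' : Fin m) (y y' : Fin n) : Set where
    constructor tee
    field
      nonedge-xy   : ¬ IsEdge G x y
      nonedge-x'y' : ¬ IsEdge G x' y'
      edge-xy'     : IsEdge G x y'
      edge-x'y     : IsEdge G x' y

  HasTee : Fin m → Fin m → Set
  HasTee x x' = ∃[ y ] ∃[ y' ] Tee x x' y y'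

  hasTee? : ∀ x x' → Dec (HasTee x x')
  hasTee? x x' = any? λ y → any? λ y' →
    map′ (λ (a , b , c , d) → tee a b c d)
         (λ (tee a b c d) → a , b , c , d)
         (¬? (edge? x y) ×-dec ¬? (edge? x' y') ×-dec edge? x y' ×-dec edge? x' y)
    where
    edge? : ∀ x y → Dec (IsEdge G x y)
    edge? x y = BipGraph.adj G x y ≟ᵇ true

  swapTee : ∀ {x x' y y'} → Tee x x' y y' → Tee x' x y' y
  swapTee (tee a b c d) = tee b a d c

  diagonal₁ diagonal₂ : ∀ {x x' y y'} → Tee x x' y y' → Edge G
  diagonal₁ {x} {y' = y'} t = (x , y') , Tee.edge-xy' t
  diagonal₂ {x' = x'} {y} t = (x' , y) , Tee.edge-x'y t

  diagonals-independent : ∀ {x x' y y'} (t : Tee x x' y y') →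
    Independent G (diagonal₁ t) (diagonal₂ t)
  diagonals-independent (tee ¬xy ¬x'y' xy' x'y) =
    (λ { refl → ¬xy x'y }) , (λ { refl → ¬xy xy' }) , ¬xy , ¬x'y'

-- Viewed in the transpose, a T-configuration on (x , x') is one on (y , y')
-- whose diagonals are those of the original, exchanged.
transposeTee : ∀ {m n} {G : BipGraph m n} {x x' y y'} →
  Tee G x x' y y' → Tee (transpose G) y y' x x'
transposeTee (tee a b c d) = tee a b d c

module Oriented {m n : ℕ} (G : BipGraph m n) (R : Edge G → Edge G → Set)
  (isTO : IsTransitiveOrientation (Independent G) R) where

  private
    comparable : ∀ u v → Independent G u v → R u v ⊎ R v u
    comparable = proj₁ isTO
    independent : ∀ u v → R u v → Independent G u v
    independent = proj₁ (proj₂ (proj₂ isTO))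
    transitive : ∀ u v w → R u v → R v w → R u w
    transitive = proj₂ (proj₂ (proj₂ isTO))

  common-end-incomparable : ∀ {x y y'} {p : IsEdge G x y} {q : IsEdge G x y'} →
    ¬ R ((x , y) , p) ((x , y') , q)
  common-end-incomparable r = proj₁ (independent _ _ r) refl

  Forward Backward : ∀ {x x' y y'} → Tee G x x' y y' → Set
  Forward  t = R (diagonal₁ G t) (diagonal₂ G t)
  Backward t = R (diagonal₂ G t) (diagonal₁ G t)

  -- Compare xy₁' with x'y₂; either direction, composed with
  -- one of the given arcs, relates two edges with a common X-endpoint.
  forward-coherent : ∀ {x x' y₁ y₁' y₂ y₂'}
    (t₁ : Tee G x x' y₁ y₁') → Forward t₁ →
    (t₂ : Tee G x x' y₂ y₂') → ¬ Backward t₂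
  forward-coherent t₁@(tee _ ¬x'y₁' xy₁' _) fwd₁ t₂@(tee ¬xy₂ _ _ x'y₂) bwd₂
    with comparable (diagonal₁ G t₁) (diagonal₂ G t₂) independent₁₂
    where
    independent₁₂ : Independent G (diagonal₁ G t₁) (diagonal₂ G t₂)
    independent₁₂ = proj₁ (diagonals-independent G t₁)
                  , (λ { refl → ¬x'y₁' x'y₂ }) , ¬xy₂ , ¬x'y₁'
  ... | inj₁ r = common-end-incomparable (transitive _ _ _ r bwd₂)
  ... | inj₂ r = common-end-incomparable (transitive _ _ _ r fwd₁)

  forward-or-backward : ∀ {x x' y y'} (t : Tee G x x' y y') → Forward t ⊎ Backward t
  forward-or-backward t = comparable _ _ (diagonals-independent G t)

  Precedes : Fin m → Fin m → Set
  Precedes x x' = ∃[ y ] ∃[ y' ] Σ (Tee G x x' y y') Forward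

  precedes-total : ∀ {x x'} → HasTee G x x' → Precedes x x' ⊎ Precedes x' x
  precedes-total (y , y' , t) with forward-or-backward t
  ... | inj₁ fwd = inj₁ (y , y' , t , fwd)
  ... | inj₂ bwd = inj₂ (y' , y , swapTee G t , bwd)

  precedes-sound : ∀ {x x'} → Precedes x x' → HasTee G x x'
  precedes-sound (y , y' , t , _) = y , y' , t

  precedes-asym : ∀ {x x'} → Precedes x x' → ¬ Precedes x' x
  precedes-asym (_ , _ , t₁ , fwd₁) (_ , _ , t₂ , fwd₂) =
    forward-coherent t₁ fwd₁ (swapTee G t₂) fwd₂

  open Completion (HasTee G) (hasTee? G) Precedes
    precedes-total precedes-sound precedes-asym public

module _ {m n : ℕ} (G : BipGraph m n) (R : Edge G → Edge G → Set)
  (isTO : IsTransitiveOrientation (Independent G) R) where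

  transposed-orientation :
    IsTransitiveOrientation (Independent (transpose G))
      (λ u v → R (flipEdge G u) (flipEdge G v))
  transposed-orientation = pullback-transitive (flipEdge G)
    (independent-transpose G) (independent-untranspose G) isTO

  private
    module X = Oriented G R isTO
    module Y = Oriented (transpose G) _ transposed-orientation

  orientation : ComplementOrientation G
  orientation = record
    { arcX = X.arc ; arcY = Y.arc
    ; arcX-irrefl = X.arc-irrefl ; arcY-irrefl = Y.arc-irrefl
    ; arcX-total = X.arc-total ; arcY-total = Y.arc-total
    ; arcX-asym = X.arc-asym ; arcY-asym = Y.arc-asym }

  -- On a T-configuration t, x → x' forces every configuration on (x , x') to
  -- be forward and y → y' forces every one on (y , y') in the transpose to be
  -- forward, i.e. backward in G; t itself is one or the other.
  no-oriented-tee : ∀ {x x' y y'} (t : Tee G x x' y y') → ¬ (X.arc x x' × Y.arc y y')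
  no-oriented-tee {x} {x'} {y} {y'} t (x→x' , y→y')
    with X.arc-agrees x→x' (y , y' , t) | Y.arc-agrees y→y' (x , x' , transposeTee t)
       | X.forward-or-backward t
  ... | _ , _ , t₁ , fwd₁ | _ | inj₂ bwd = X.forward-coherent t₁ fwd₁ t bwd
  ... | _ | _ , _ , s₂ , fwd₂ | inj₁ fwd = Y.forward-coherent s₂ fwd₂ (transposeTee t) fwd

  orientation-TFree : TFree G orientation
  orientation-TFree x x' y y' ¬xy ¬x'y' xy' x'y = no-oriented-tee (tee ¬xy ¬x'y' xy' x'y)

proposition2p5 : (m n : ℕ) (G : BipGraph m n) →
    IComparability G →
    Σ (ComplementOrientation G) (λ O → TFree G O)
proposition2p5 m n G (R , isTO) = orientation G R isTO , orientation-TFree G R isTO
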